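{- For every $n\ge1$, the path on $n$ vertices is $123$-representable.
   Context: A word is a finite sequence of letters from a totally ordered alphabet. Two letters $x,y$ alternate in a word $w$ if between any two occurrences of $x$ there is an occurrence of $y$ and between any two occurrences of $y$ there is an occurrence of $x$. A graph $G=(V,E)$ is represented by a word $w$ over $V$ if for all distinct $x,y\in V$, $x$ and $y$ alternate in $w$ if and only if $xy\in E$. A word is $123$-avoiding if it has no strictly increasing subsequence of length $3$. A graph is $123$-representable if, after labeling its vertices by distinct elements of a totally ordered set (any labeling may be chosen), it is represented by a $123$-avoiding word. -}

module Defs where

open import Data.Nat using (ℕ; suc; _<_)
open import Data.Fin using (Fin; toℕ)
open import Data.List using (List; length; lookup)
open import Data.List.Membership.Propositional using (_∈_)
open import Data.Product using (Σ; _×_; ∃-syntax)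
open import Data.Sum using (_⊎_)
open import Relation.Nullary using (¬_)
open import Relation.Binary.PropositionalEquality using (_≡_; _≢_)
open import Function.Definitions using (Injective)

module _ {A : Set} where
  _!_ : (w : List A) → Fin (length w) → A
  w ! i = lookup w i

  Separates : List A → A → A → Set
  Separates w x y =
    ∀ (i j : Fin (length w)) → toℕ i < toℕ j → w ! i ≡ x → w ! j ≡ x →
      ∃[ k ] (toℕ i < toℕ k × toℕ k < toℕ j × w ! k ≡ y)

  Alternate : List A → A → A → Set
  Alternate w x y = Separates w x y × Separates w y x

Represents : {V : Set} → (V → V → Set) → List V → Set
Represents {V} E w =
  (∀ (x : V) → x ∈ w) ×
  (∀ (x y : V) → x ≢ y → (Alternate w x y → E x y) × (E x y → Alternate w x y))

Avoids123 : {V : Set} → (V → ℕ) → List V → Set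
Avoids123 ℓ w =
  ¬ (∃[ i ] ∃[ j ] ∃[ k ]
       (toℕ i < toℕ j × toℕ j < toℕ k ×
        ℓ (w ! i) < ℓ (w ! j) × ℓ (w ! j) < ℓ (w ! k)))

-- A graph is 123-representable if for some labelling of its vertices by
-- distinct elements of a totally ordered set (here ℕ) it is represented by a
-- 123-avoiding word.
Representable123 : {V : Set} → (V → V → Set) → Set
Representable123 {V} E =
  ∃[ ℓ ] (Injective _≡_ _≡_ ℓ × ∃[ w ] (Represents E w × Avoids123 ℓ w))

PathEdge : (n : ℕ) → Fin n → Fin n → Set
PathEdge n x y = (suc (toℕ x) ≡ toℕ y) ⊎ (suc (toℕ y) ≡ toℕ x)

module Submission where

open import Defs
open import Data.Nat using (ℕ; zero; suc; _+_; _∸_; _≤_; _<_; _≥_; _≤?_; z≤n; s≤s)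
open import Data.Nat.Properties
open import Data.Fin using (Fin; toℕ; fromℕ<; cast)
open import Data.Fin.Properties using (toℕ-injective; toℕ<n; toℕ-fromℕ<; toℕ-cast; cast-involutive)
open import Data.List using (List; length; tabulate)
open import Data.List.Properties using (length-tabulate; lookup-tabulate)
open import Data.List.Membership.Propositional using (_∈_)
open import Data.List.Membership.Propositional.Properties using (∈-lookup)
open import Data.Product using (_×_; _,_; ∃-syntax)
open import Data.Sum using (_⊎_; inj₁; inj₂)
open import Function using (_∘_)
open import Function.Definitions using (Injective)
open import Relation.Nullary using (¬_; yes; no; contradiction)
open import Relation.Binary using (tri<; tri≈; tri>)
open import Relation.Binary.PropositionalEquality

-- The path 0 - 1 - ... - m is represented by the word 0 1 0 2 1 3 2 ... m (m-1):
-- vertex a occurs at positions 2a-1 and 2a+2 (only at 0 and 2 when a = 0),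
-- so between its two occurrences lie exactly the letters a+1 and a-1.  Every
-- letter is at least each letter two or more positions earlier, hence in a
-- length-3 subsequence the last letter is at least the first; labelling vertex
-- x by m - x reverses this, so no such subsequence is strictly increasing.

double≤suc-double⇒≤ : ∀ {a b} → a + a ≤ suc (b + b) → a ≤ b
double≤suc-double⇒≤ {a} {b} a+a≤ with a ≤? b
... | yes a≤b = a≤b
... | no a≰b = contradiction (≤-trans 2+2b≤a+a a+a≤) 1+n≰n
  where
  2+2b≤a+a : suc (suc b) + b ≤ a + a
  2+2b≤a+a = subst (_≤ a + a) (+-suc (suc b) b) (+-mono-≤ (≰⇒> a≰b) (≰⇒> a≰b))

zigzag : ℕ → ℕ
zigzag 0 = 0
zigzag 1 = 1
zigzag 2 = 0
zigzag (suc (suc (suc p))) = suc (zigzag (suc p))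

firstOcc : ℕ → ℕ
firstOcc zero = zero
firstOcc (suc a) = suc (a + a)

secondOcc : ℕ → ℕ
secondOcc a = suc (suc (a + a))

firstOcc-suc-suc : ∀ a → firstOcc (suc (suc a)) ≡ suc (suc (firstOcc (suc a)))
firstOcc-suc-suc a = cong (suc ∘ suc) (+-suc a a)

secondOcc-suc : ∀ a → secondOcc (suc a) ≡ suc (suc (secondOcc a))
secondOcc-suc a = cong (suc ∘ suc ∘ suc) (+-suc a a)

firstOcc≤double : ∀ a → firstOcc a ≤ a + a
firstOcc≤double zero = z≤n
firstOcc≤double (suc a) = m≤n⇒m≤1+n (≤-reflexive (sym (+-suc a a)))

firstOcc<secondOcc : ∀ a → firstOcc a < secondOcc a
firstOcc<secondOcc a = s≤s (m≤n⇒m≤1+n (firstOcc≤double a))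

zigzag-firstOcc : ∀ a → zigzag (firstOcc a) ≡ a
zigzag-firstOcc 0 = refl
zigzag-firstOcc 1 = refl
zigzag-firstOcc (suc (suc a)) =
  trans (cong zigzag (firstOcc-suc-suc a)) (cong suc (zigzag-firstOcc (suc a)))

zigzag-secondOcc : ∀ a → zigzag (secondOcc a) ≡ a
zigzag-secondOcc zero = refl
zigzag-secondOcc (suc a) =
  trans (cong zigzag (secondOcc-suc a)) (cong suc (zigzag-secondOcc a))

zigzag-occurrence : ∀ p {a} → zigzag p ≡ a → p ≡ firstOcc a ⊎ p ≡ secondOcc a
zigzag-occurrence 0 refl = inj₁ refl
zigzag-occurrence 1 refl = inj₁ refl
zigzag-occurrence 2 refl = inj₂ refl
zigzag-occurrence (suc (suc (suc p))) refl with zigzag-occurrence (suc p) refl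
... | inj₁ p+1≡first with zigzag (suc p)
...   | zero = contradiction p+1≡first λ ()
...   | suc a = inj₁ (trans (cong (suc ∘ suc) p+1≡first) (sym (firstOcc-suc-suc a)))
zigzag-occurrence (suc (suc (suc p))) refl | inj₂ p+1≡second =
  inj₂ (trans (cong (suc ∘ suc) p+1≡second) (sym (secondOcc-suc (zigzag (suc p)))))

zigzag-occurrences : ∀ {i j a} → i < j → zigzag i ≡ a → zigzag j ≡ a →
                     i ≡ firstOcc a × j ≡ secondOcc a
zigzag-occurrences {i} {j} {a} i<j zi zj with zigzag-occurrence i zi | zigzag-occurrence j zj
... | inj₁ i≡ | inj₁ j≡ = contradiction (trans i≡ (sym j≡)) (<⇒≢ i<j)
... | inj₁ i≡ | inj₂ j≡ = i≡ , j≡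
... | inj₂ i≡ | inj₁ j≡ = contradiction (subst₂ _<_ i≡ j≡ i<j) (<-asym (firstOcc<secondOcc a))
... | inj₂ i≡ | inj₂ j≡ = contradiction (trans i≡ (sym j≡)) (<⇒≢ i<j)

zigzag-double≤ : ∀ p → zigzag p + zigzag p ≤ suc p
zigzag-double≤ 0 = z≤n
zigzag-double≤ 1 = s≤s (s≤s z≤n)
zigzag-double≤ 2 = z≤n
zigzag-double≤ (suc (suc (suc p))) =
  ≤-trans (≤-reflexive (cong suc (+-suc z z))) (s≤s (s≤s (zigzag-double≤ (suc p))))
  where z = zigzag (suc p)

zigzag≤zigzag-2+ : ∀ p → zigzag p ≤ zigzag (suc (suc p))
zigzag≤zigzag-2+ 0 = z≤n
zigzag≤zigzag-2+ 1 = s≤s z≤n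
zigzag≤zigzag-2+ 2 = z≤n
zigzag≤zigzag-2+ (suc (suc (suc p))) = s≤s (zigzag≤zigzag-2+ (suc p))

zigzag≤zigzag-3+ : ∀ p → zigzag p ≤ zigzag (suc (suc (suc p)))
zigzag≤zigzag-3+ 0 = z≤n
zigzag≤zigzag-3+ 1 = s≤s z≤n
zigzag≤zigzag-3+ 2 = z≤n
zigzag≤zigzag-3+ (suc (suc (suc p))) = s≤s (zigzag≤zigzag-3+ (suc p))

zigzag≤zigzag-+2+ : ∀ d p → zigzag p ≤ zigzag (d + suc (suc p))
zigzag≤zigzag-+2+ 0 p = zigzag≤zigzag-2+ p
zigzag≤zigzag-+2+ 1 p = zigzag≤zigzag-3+ p
zigzag≤zigzag-+2+ (suc (suc d)) p =
  ≤-trans (zigzag≤zigzag-+2+ d p) (zigzag≤zigzag-2+ (d + suc (suc p)))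

zigzag-mono-≤ : ∀ {p q} → suc (suc p) ≤ q → zigzag p ≤ zigzag q
zigzag-mono-≤ {p} p+2≤q with m≤n⇒∃[o]m+o≡n p+2≤q
... | d , refl = subst (λ q → zigzag p ≤ zigzag q) (+-comm d (suc (suc p))) (zigzag≤zigzag-+2+ d p)

SeparatesBelow : {B : Set} → ℕ → (ℕ → B) → B → B → Set
SeparatesBelow n f a b =
  ∀ i j → i < j → j < n → f i ≡ a → f j ≡ a → ∃[ k ] (i < k × k < j × f k ≡ b)

AlternatesBelow : {B : Set} → ℕ → (ℕ → B) → B → B → Set
AlternatesBelow n f a b = SeparatesBelow n f a b × SeparatesBelow n f b a

Adjacent : ℕ → ℕ → Set
Adjacent a b = suc a ≡ b ⊎ suc b ≡ a

secondOcc≡double-suc : ∀ a → secondOcc a ≡ suc a + suc a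
secondOcc≡double-suc a = cong suc (sym (+-suc a a))

secondOcc≤double : ∀ {a b} → suc a ≤ b → secondOcc a ≤ b + b
secondOcc≤double {a} a<b = ≤-trans (≤-reflexive (secondOcc≡double-suc a)) (+-mono-≤ a<b a<b)

adjacent⇒separatesBelow : ∀ {n a b} → Adjacent a b → SeparatesBelow n zigzag a b
adjacent⇒separatesBelow {a = a} (inj₁ refl) i j i<j _ zi zj with zigzag-occurrences i<j zi zj
... | refl , refl = firstOcc (suc a) , s≤s (firstOcc≤double a) , ≤-refl , zigzag-firstOcc (suc a)
adjacent⇒separatesBelow {b = b} (inj₂ refl) i j i<j _ zi zj with zigzag-occurrences i<j zi zj
... | refl , refl =
  secondOcc b , ≤-refl , subst (secondOcc b <_) (sym (secondOcc-suc b)) (m<n⇒m<1+n ≤-refl) ,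
  zigzag-secondOcc b

adjacent⇒alternatesBelow : ∀ {n a b} → Adjacent a b → AlternatesBelow n zigzag a b
adjacent⇒alternatesBelow (inj₁ e) = adjacent⇒separatesBelow (inj₁ e) , adjacent⇒separatesBelow (inj₂ e)
adjacent⇒alternatesBelow (inj₂ e) = adjacent⇒separatesBelow (inj₂ e) , adjacent⇒separatesBelow (inj₁ e)

-- The occurrences of a enclose only positions of letters at most a + 1.
¬separatesBelow-far : ∀ {n a b} → b + b < n → suc a < b → ¬ SeparatesBelow n zigzag a b
¬separatesBelow-far {a = a} {b} b+b<n a+1<b sep
  with sep (firstOcc a) (secondOcc a) (firstOcc<secondOcc a)
           (≤-<-trans (secondOcc≤double (<⇒≤ a+1<b)) b+b<n) (zigzag-firstOcc a) (zigzag-secondOcc a)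
... | k , _ , k<second , zk≡b = <⇒≱ a+1<b (double≤suc-double⇒≤ b+b≤)
  where
  open ≤-Reasoning
  b+b≤ : b + b ≤ suc (suc a + suc a)
  b+b≤ = begin
    b + b                   ≡⟨ cong (λ c → c + c) zk≡b ⟨
    zigzag k + zigzag k     ≤⟨ zigzag-double≤ k ⟩
    suc k                   ≤⟨ k<second ⟩
    secondOcc a             ≡⟨ secondOcc≡double-suc a ⟩
    suc a + suc a           ≤⟨ n≤1+n _ ⟩
    suc (suc a + suc a)     ∎

separatesBelow-upward⇒suc : ∀ {n a b} → a < b → b + b < n → SeparatesBelow n zigzag a b → suc a ≡ b
separatesBelow-upward⇒suc a<b b+b<n a|b with m≤n⇒m<n∨m≡n a<b
... | inj₁ a+1<b = contradiction a|b (¬separatesBelow-far b+b<n a+1<b)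
... | inj₂ a+1≡b = a+1≡b

alternatesBelow⇒adjacent : ∀ {n a b} → a ≢ b → a + a < n → b + b < n →
                           AlternatesBelow n zigzag a b → Adjacent a b
alternatesBelow⇒adjacent {a = a} {b} a≢b a+a<n b+b<n (a|b , b|a) with <-cmp a b
... | tri< a<b _ _ = inj₁ (separatesBelow-upward⇒suc a<b b+b<n a|b)
... | tri≈ _ a≡b _ = contradiction a≡b a≢b
... | tri> _ _ b<a = inj₂ (separatesBelow-upward⇒suc b<a a+a<n b|a)

module Spelling {A B : Set} (φ : A → B) (φ-injective : Injective _≡_ _≡_ φ)
                (f : ℕ → B) (w : List A) (spells : ∀ i → φ (w ! i) ≡ f (toℕ i)) where

  private
    position : ∀ {p} → p < length w → ∃[ i ] toℕ i ≡ p
    position p<n = fromℕ< p<n , toℕ-fromℕ< p<n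

    letter⇒ : ∀ {i x} → w ! i ≡ x → f (toℕ i) ≡ φ x
    letter⇒ {i} wi≡x = trans (sym (spells i)) (cong φ wi≡x)

    letter⇐ : ∀ {i x} → f (toℕ i) ≡ φ x → w ! i ≡ x
    letter⇐ {i} fi≡φx = φ-injective (trans (spells i) fi≡φx)

  separates⇒separatesBelow : ∀ {x y} → Separates w x y → SeparatesBelow (length w) f (φ x) (φ y)
  separates⇒separatesBelow sep _ _ i<j j<n fi fj
    with position (<-trans i<j j<n) | position j<n
  ... | i , refl | j , refl with sep i j i<j (letter⇐ fi) (letter⇐ fj)
  ... | k , i<k , k<j , wk = toℕ k , i<k , k<j , letter⇒ wk

  separatesBelow⇒separates : ∀ {x y} → SeparatesBelow (length w) f (φ x) (φ y) → Separates w x y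
  separatesBelow⇒separates sep i j i<j wi wj
    with sep (toℕ i) (toℕ j) i<j (toℕ<n j) (letter⇒ wi) (letter⇒ wj)
  ... | _ , i<k , k<j , fk with position (<-trans k<j (toℕ<n j))
  ... | k , refl = k , i<k , k<j , letter⇐ fk

  alternate⇒alternatesBelow : ∀ {x y} → Alternate w x y → AlternatesBelow (length w) f (φ x) (φ y)
  alternate⇒alternatesBelow (x|y , y|x) = separates⇒separatesBelow x|y , separates⇒separatesBelow y|x

  alternatesBelow⇒alternate : ∀ {x y} → AlternatesBelow (length w) f (φ x) (φ y) → Alternate w x y
  alternatesBelow⇒alternate (x|y , y|x) = separatesBelow⇒separates x|y , separatesBelow⇒separates y|x

  ∈-spelled : ∀ {p x} → p < length w → f p ≡ φ x → x ∈ w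
  ∈-spelled p<n fp with position p<n
  ... | i , refl = subst (_∈ w) (letter⇐ fp) (∈-lookup i)

avoids123-if-antitone-at-distance-2 : ∀ {A : Set} (ℓ : A → ℕ) (w : List A) →
  (∀ i k → suc (suc (toℕ i)) ≤ toℕ k → ℓ (w ! k) ≤ ℓ (w ! i)) → Avoids123 ℓ w
avoids123-if-antitone-at-distance-2 ℓ w antitone (i , j , k , i<j , j<k , ℓi<ℓj , ℓj<ℓk) =
  <⇒≱ (<-trans ℓi<ℓj ℓj<ℓk) (antitone i k (≤-trans (s≤s i<j) j<k))

module ZigzagWord (m : ℕ) where

  zigzag≤ : ∀ {p} → p < suc (m + m) → zigzag p ≤ m
  zigzag≤ {p} p<n = double≤suc-double⇒≤ (≤-trans (zigzag-double≤ p) p<n)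

  letter : Fin (suc (m + m)) → Fin (suc m)
  letter i = fromℕ< (s≤s (zigzag≤ (toℕ<n i)))

  word : List (Fin (suc m))
  word = tabulate letter

  length-word : length word ≡ suc (m + m)
  length-word = length-tabulate letter

  word-spells : ∀ i → toℕ (word ! i) ≡ zigzag (toℕ i)
  word-spells i = begin
    toℕ (word ! i)                      ≡⟨ cong (toℕ ∘ (word !_)) (cast-involutive (sym length-word) length-word i) ⟨
    toℕ (word ! cast (sym length-word) (cast length-word i))
                                        ≡⟨ cong toℕ (lookup-tabulate letter (cast length-word i)) ⟩
    toℕ (letter (cast length-word i))   ≡⟨ toℕ-fromℕ< _ ⟩
    zigzag (toℕ (cast length-word i))   ≡⟨ cong zigzag (toℕ-cast length-word i) ⟩
    zigzag (toℕ i)                      ∎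
    where open ≡-Reasoning

  open Spelling toℕ toℕ-injective zigzag word word-spells

  double<length : ∀ (x : Fin (suc m)) → toℕ x + toℕ x < length word
  double<length x = subst (toℕ x + toℕ x <_) (sym length-word) (s≤s (+-mono-≤ x≤m x≤m))
    where x≤m = ≤-pred (toℕ<n x)

  represents : Represents (PathEdge (suc m)) word
  represents = every-vertex-occurs , λ x y x≢y → alternate⇒edge x≢y , edge⇒alternate
    where
    every-vertex-occurs : ∀ x → x ∈ word
    every-vertex-occurs x =
      ∈-spelled (≤-<-trans (firstOcc≤double (toℕ x)) (double<length x)) (zigzag-firstOcc (toℕ x))

    alternate⇒edge : ∀ {x y} → x ≢ y → Alternate word x y → PathEdge (suc m) x y
    alternate⇒edge {x} {y} x≢y alt =
      alternatesBelow⇒adjacent (x≢y ∘ toℕ-injective) (double<length x) (double<length y)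
                               (alternate⇒alternatesBelow alt)

    edge⇒alternate : ∀ {x y} → PathEdge (suc m) x y → Alternate word x y
    edge⇒alternate edge = alternatesBelow⇒alternate (adjacent⇒alternatesBelow edge)

  label : Fin (suc m) → ℕ
  label x = m ∸ toℕ x

  label-injective : Injective _≡_ _≡_ label
  label-injective {x} {y} = toℕ-injective ∘ ∸-cancelˡ-≡ (≤-pred (toℕ<n x)) (≤-pred (toℕ<n y))

  avoids123 : Avoids123 label word
  avoids123 = avoids123-if-antitone-at-distance-2 label word λ i k i+2≤k →
    ∸-monoʳ-≤ m (subst₂ _≤_ (sym (word-spells i)) (sym (word-spells k)) (zigzag-mono-≤ i+2≤k))

theorem3p10 : (n : ℕ) → n ≥ 1 → Representable123 (PathEdge n)
theorem3p10 zero ()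
theorem3p10 (suc m) _ = label , label-injective , word , represents , avoids123
  where open ZigzagWord m
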